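{- Let $(G,\sigma)$ be a connected bipartite graph with $\sigma$ the vertex 2-coloring given by its bipartition. If $G$ contains none of $P_6$, $C_6$, $\mathrm{Sunlet}_4$ as an induced subgraph, then $G$ has a heart-vertex, i.e., a vertex adjacent to all vertices of the opposite color.
   Context: $P_6$ is the path on six vertices, $C_6$ the cycle on six vertices, and $\mathrm{Sunlet}_4$ is the eight-vertex graph obtained from the 4-cycle $C_4$ by attaching one pendant vertex to each of its four vertices. -}

module Defs where

open import Data.Nat using (ℕ; suc)
open import Data.Fin using (Fin; toℕ)
open import Data.Bool using (Bool)
open import Data.Product using (Σ; _×_; _,_)
open import Data.List using (List; []; _∷_)
open import Data.List.Membership.Propositional using (_∈_)
open import Data.Sum using (_⊎_)
open import Relation.Nullary using (¬_; Dec)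
open import Relation.Binary.PropositionalEquality using (_≡_; _≢_)
open import Function.Bundles using (_⇔_)
open import Function.Definitions using (Injective)

record Graph (n : ℕ) : Set₁ where
  field
    Adj      : Fin n → Fin n → Set
    adj-dec  : ∀ u v → Dec (Adj u v)
    adj-sym  : ∀ {u v} → Adj u v → Adj v u
    adj-irr  : ∀ {u} → ¬ Adj u u
open Graph public

data Walk {n : ℕ} (G : Graph n) : Fin n → Fin n → Set where
  here : ∀ {u} → Walk G u u
  step : ∀ {u v w} → Adj G u v → Walk G v w → Walk G u w

Connected : ∀ {n} → Graph n → Set
Connected {n} G = Fin n × (∀ u v → Walk G u v)

ProperTwoColouring : ∀ {n} → Graph n → (Fin n → Bool) → Set
ProperTwoColouring G σ = ∀ u v → Adj G u v → σ u ≢ σ v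

InducedSubgraph : ∀ {k n} → Graph k → Graph n → Set
InducedSubgraph {k} {n} H G =
  Σ (Fin k → Fin n) λ f → Injective _≡_ _≡_ f × (∀ i j → Adj H i j ⇔ Adj G (f i) (f j))

HeartVertex : ∀ {n} → Graph n → (Fin n → Bool) → Fin n → Set
HeartVertex G σ v = ∀ u → σ u ≢ σ v → Adj G v u

open import Data.Nat.Properties using () renaming (_≟_ to _≟ℕ_)
open import Data.Product.Properties using (≡-dec)
open import Data.List.Relation.Unary.Any using (any?)
open import Data.Sum.Base using (inj₁; inj₂)
open import Data.List.Relation.Unary.Any using (Any; here; there)
open import Relation.Binary.PropositionalEquality using (refl; sym; cong)
open import Relation.Nullary using (yes; no)
open import Relation.Nullary.Decidable using (_⊎-dec_)
import Data.Nat.Properties as NP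
open import Data.Empty using (⊥)

EdgeAdj : ∀ {n} → List (ℕ × ℕ) → Fin n → Fin n → Set
EdgeAdj es i j = ((toℕ i , toℕ j) ∈ es) ⊎ ((toℕ j , toℕ i) ∈ es)

P6-edges C6-edges Sunlet4-edges : List (ℕ × ℕ)
P6-edges = (0 , 1) ∷ (1 , 2) ∷ (2 , 3) ∷ (3 , 4) ∷ (4 , 5) ∷ []
C6-edges = (0 , 1) ∷ (1 , 2) ∷ (2 , 3) ∷ (3 , 4) ∷ (4 , 5) ∷ (5 , 0) ∷ []
Sunlet4-edges = (0 , 1) ∷ (1 , 2) ∷ (2 , 3) ∷ (3 , 0)
              ∷ (0 , 4) ∷ (1 , 5) ∷ (2 , 6) ∷ (3 , 7) ∷ []

private
  pair-dec : (p q : ℕ × ℕ) → Dec (p ≡ q)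
  pair-dec = ≡-dec _≟ℕ_ _≟ℕ_

  mem-dec : (p : ℕ × ℕ) (es : List (ℕ × ℕ)) → Dec (p ∈ es)
  mem-dec p es = any? (pair-dec p) es

  LoopFree : List (ℕ × ℕ) → Set
  LoopFree es = ∀ a → ¬ ((a , a) ∈ es)

  edgeAdj-irr : ∀ {n} es → LoopFree es → {u : Fin n} → ¬ EdgeAdj es u u
  edgeAdj-irr es lf {u} (inj₁ m) = lf (toℕ u) m
  edgeAdj-irr es lf {u} (inj₂ m) = lf (toℕ u) m

  swap : ∀ {n} es {u v : Fin n} → EdgeAdj es u v → EdgeAdj es v u
  swap es (inj₁ m) = inj₂ m
  swap es (inj₂ m) = inj₁ m

  lf-P6 : LoopFree P6-edges
  lf-P6 a (here ())
  lf-P6 a (there (here ()))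
  lf-P6 a (there (there (here ())))
  lf-P6 a (there (there (there (here ()))))
  lf-P6 a (there (there (there (there (here ())))))
  lf-P6 a (there (there (there (there (there ())))))

  lf-C6 : LoopFree C6-edges
  lf-C6 a (here ())
  lf-C6 a (there (here ()))
  lf-C6 a (there (there (here ())))
  lf-C6 a (there (there (there (here ()))))
  lf-C6 a (there (there (there (there (here ())))))
  lf-C6 a (there (there (there (there (there (here ()))))))
  lf-C6 a (there (there (there (there (there (there ()))))))

  lf-S4 : LoopFree Sunlet4-edges
  lf-S4 a (here ())
  lf-S4 a (there (here ()))
  lf-S4 a (there (there (here ())))
  lf-S4 a (there (there (there (here ()))))
  lf-S4 a (there (there (there (there (here ())))))
  lf-S4 a (there (there (there (there (there (here ()))))))
  lf-S4 a (there (there (there (there (there (there (here ())))))))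
  lf-S4 a (there (there (there (there (there (there (there (here ()))))))))
  lf-S4 a (there (there (there (there (there (there (there (there ()))))))))

edgeGraph : (n : ℕ) (es : List (ℕ × ℕ)) → (∀ a → ¬ ((a , a) ∈ es)) → Graph n
edgeGraph n es lf = record
  { Adj = EdgeAdj es
  ; adj-dec = λ u v → mem-dec (toℕ u , toℕ v) es ⊎-dec mem-dec (toℕ v , toℕ u) es
  ; adj-sym = swap es
  ; adj-irr = edgeAdj-irr es lf
  }

P6 : Graph 6
P6 = edgeGraph 6 P6-edges lf-P6

C6 : Graph 6
C6 = edgeGraph 6 C6-edges lf-C6

Sunlet4 : Graph 8
Sunlet4 = edgeGraph 8 Sunlet4-edges lf-S4

-- Let v have maximum degree; if v is not a heart, fix y on the other side with y ∉ N(v) and a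
-- neighbour a₀ of y. Maximality gives, for any a with a neighbour outside N(v), a neighbour of v
-- outside N(a). With this, an induced P6 shows that every vertex of v's side shares a neighbour with
-- v, and an induced P6 or C6 shows that N(v) ∩ N(b) is ⊆-comparable with every N(v) ∩ N(a) as soon as
-- b has a neighbour outside N(v). Now take aₘ on v's side with |N(v) ∩ N(aₘ)| minimal and h in it.
-- By minimality, a vertex u of v's side missing h has a neighbour x′ ∈ N(v) outside N(aₘ), and then
-- a₀ yields either an incomparable pair or an induced Sunlet4 on the square v h a₀ x′ with pendants
-- at v, h, a₀ and x′. So h is a heart vertex.

module Submission where

open import Defs
open import Data.Nat using (ℕ; _≤_)
open import Data.Nat.Properties using (<⇒≱) renaming (_≟_ to _≟ℕ_)
open import Data.Fin using (Fin; toℕ; #_)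
open import Data.Fin.Properties using (toℕ-injective; any?; all?; ¬∀⟶∃¬) renaming (_≟_ to _≟F_)
open import Data.Fin.Subset using (Subset; ∣_∣) renaming (_∈_ to _∈ₛ_; _⊆_ to _⊆ₛ_)
open import Data.Fin.Subset.Properties using (p⊂q⇒∣p∣<∣q∣)
open import Data.Bool using (Bool; true; false; not; _xor_)
open import Data.Bool.Properties using (¬-not; not-involutive) renaming (_≟_ to _≟B_)
open import Data.Vec using (Vec; lookup; tabulate) renaming ([] to []ᵥ; _∷_ to _∷ᵥ_)
open import Data.Vec.Relation.Binary.Pointwise.Inductive as Pointwise using (Pointwise) renaming ([] to []ₚ; _∷_ to _∷ₚ_)
open import Data.Vec.Properties using (lookup∘tabulate; []=⇒lookup; lookup⇒[]=)
open import Data.List using (List; []; _∷_; allFin; filter)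
open import Data.List.Membership.Propositional.Properties using (∈-allFin; ∈-filter⁺)
open import Data.List.Relation.Unary.All as All using (All; []; _∷_)
open import Data.List.Relation.Unary.All.Properties using (all-filter)
open import Data.List.Relation.Unary.Any using () renaming (any? to anyₗ?)
open import Data.List.Extrema.Nat using (argmin; argmax; argmin-all; f[argmin]≤f[xs]; f[xs]≤f[argmax])
open import Data.Product using (Σ; Σ-syntax; ∃; ∃-syntax; _×_; _,_; proj₁; proj₂)
open import Data.Product.Properties using (≡-dec)
open import Data.Sum using (_⊎_; inj₁; inj₂)
open import Data.Empty using (⊥; ⊥-elim)
open import Function using (_∘_; id)
open import Function.Bundles using (_⇔_; mk⇔; Equivalence)
open import Relation.Nullary using (¬_; Dec; yes; no; does)
open import Relation.Nullary.Decidable using (_⊎-dec_; _×-dec_; _→-dec_; ¬?; from-yes; dec-true; decidable-stable)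
open import Relation.Unary using (Pred; Decidable)
open import Relation.Binary.PropositionalEquality using (_≡_; _≢_; refl; sym; trans; cong; subst)

≢∧≢⇒≡ : {a b c : Bool} → a ≢ c → b ≢ c → a ≡ b
≢∧≢⇒≡ a≢c b≢c = trans (¬-not a≢c) (sym (¬-not b≢c))

module _ {n p} {P : Pred (Fin n) p} (P? : Decidable P) where

  ⟦_⟧ : Subset n
  ⟦_⟧ = tabulate (λ i → does (P? i))

  ∈⟦⟧⁺ : ∀ {i} → P i → i ∈ₛ ⟦_⟧
  ∈⟦⟧⁺ {i} pi = lookup⇒[]= i _ (trans (lookup∘tabulate _ i) (dec-true (P? i) pi))

  ∈⟦⟧⁻ : ∀ {i} → i ∈ₛ ⟦_⟧ → P i
  ∈⟦⟧⁻ {i} i∈ with P? i | trans (sym (lookup∘tabulate (λ j → does (P? j)) i)) ([]=⇒lookup i∈)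
  ... | yes pi | _ = pi
  ... | no _   | ()

module _ {n p q} {P : Pred (Fin n) p} {Q : Pred (Fin n) q} (P? : Decidable P) (Q? : Decidable Q) where

  ∣⟦⟧∣≤⇒⊈ : ∣ ⟦ Q? ⟧ ∣ ≤ ∣ ⟦ P? ⟧ ∣ → ∀ {j} → Q j → ¬ P j → ∃[ i ] P i × ¬ Q i
  ∣⟦⟧∣≤⇒⊈ ∣Q∣≤∣P∣ {j} qj ¬pj with any? (λ i → P? i ×-dec ¬? (Q? i))
  ... | yes witness = witness
  ... | no ∄i = ⊥-elim (<⇒≱ (p⊂q⇒∣p∣<∣q∣ (P⊆Q , j , ∈⟦⟧⁺ Q? qj , ¬pj ∘ ∈⟦⟧⁻ P?)) ∣Q∣≤∣P∣)
    where
    P⊆Q : ⟦ P? ⟧ ⊆ₛ ⟦ Q? ⟧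
    P⊆Q {i} i∈P = ∈⟦⟧⁺ Q? (decidable-stable (Q? i) λ ¬qi → ∄i (i , ∈⟦⟧⁻ P? i∈P , ¬qi))

module _ {n} (f : Fin n → ℕ) where

  maximiser : Fin n → Σ[ a ∈ Fin n ] (∀ j → f j ≤ f a)
  maximiser i = argmax f i (allFin n) , λ j → All.lookup (f[xs]≤f[argmax] i (allFin n)) (∈-allFin j)

  minimiser : ∀ {p} {P : Pred (Fin n) p} → Decidable P → ∀ {i} → P i
            → Σ[ a ∈ Fin n ] P a × (∀ j → P j → f a ≤ f j)
  minimiser {P = P} P? {i} pi = a , argmin-all f pi (all-filter P? (allFin n)) , minimal
    where
    candidates = filter P? (allFin n)
    a = argmin f i candidates
    minimal : ∀ j → P j → f a ≤ f j
    minimal j pj = All.lookup (f[argmin]≤f[xs] i candidates) (∈-filter⁺ P? (∈-allFin j) pj)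

neighbour-of-walk-start : ∀ {n} {G : Graph n} {s t} → s ≢ t → Walk G s t → ∃ (Adj G s)
neighbour-of-walk-start s≢t here = ⊥-elim (s≢t refl)
neighbour-of-walk-start _ (step {v = w} sw _) = w , sw

TwinFree : ∀ {k} → Graph k → Set
TwinFree {k} H = ∀ i j → i ≡ j ⊎ ∃[ m ] (Adj H i m × ¬ Adj H j m ⊎ ¬ Adj H i m × Adj H j m)

twinFree? : ∀ {k} (H : Graph k) → Dec (TwinFree H)
twinFree? H = all? λ i → all? λ j → (i ≟F j) ⊎-dec any? λ m →
  (adj? i m ×-dec ¬? (adj? j m)) ⊎-dec (¬? (adj? i m) ×-dec adj? j m)
  where adj? = adj-dec H

module _ {k n} (H : Graph k) (G : Graph n) where

  twinFree⇒induced : TwinFree H → (f : Fin k → Fin n)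
    → (∀ i j → Adj H i j ⇔ Adj G (f i) (f j)) → InducedSubgraph H G
  twinFree⇒induced twinFree f adj⇔ = f , injective , adj⇔
    where
    open Equivalence
    transport : ∀ {i j} m → f i ≡ f j → Adj H i m → Adj H j m
    transport {i} {j} m fi≡fj him = from (adj⇔ j m) (subst (λ w → Adj G w (f m)) fi≡fj (to (adj⇔ i m) him))
    injective : ∀ {i j} → f i ≡ f j → i ≡ j
    injective {i} {j} fi≡fj with twinFree i j
    ... | inj₁ i≡j = i≡j
    ... | inj₂ (m , inj₁ (him , ¬hjm)) = ⊥-elim (¬hjm (transport m fi≡fj him))
    ... | inj₂ (m , inj₂ (¬him , hjm)) = ⊥-elim (¬him (transport m (sym fi≡fj) hjm))

edgeAdj? : ∀ {k} (es : List (ℕ × ℕ)) (i j : Fin k) → Dec (EdgeAdj es i j)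
edgeAdj? es i j = anyₗ? (≡-dec _≟ℕ_ _≟ℕ_ _) es ⊎-dec anyₗ? (≡-dec _≟ℕ_ _≟ℕ_ _) es

Covered : ∀ {k} → List (ℕ × ℕ) → (Fin k → Bool) → List (ℕ × ℕ) → Set
Covered {k} es c ne = (i j : Fin k) → EdgeAdj es i j ⊎ c i ≡ c j ⊎ EdgeAdj ne i j

covered? : ∀ {k} es (c : Fin k → Bool) ne → Dec (Covered es c ne)
covered? es c ne = all? λ i → all? λ j → edgeAdj? es i j ⊎-dec (c i ≟B c j) ⊎-dec edgeAdj? ne i j

module EdgeListEmbedding {n} (G : Graph n) (σ : Fin n → Bool) (proper : ProperTwoColouring G σ) where

  open Equivalence

  σ-flip : ∀ {u w} → Adj G u w → σ w ≡ not (σ u)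
  σ-flip uw = ¬-not (proper _ _ uw ∘ sym)

  σ-flip² : ∀ {u w x} → Adj G u w → Adj G w x → σ x ≡ σ u
  σ-flip² uw wx = trans (σ-flip wx) (trans (cong not (σ-flip uw)) (not-involutive _))

  module _ {k} (vs : Vec (Fin n) k) where

    Holds : (Fin n → Fin n → Set) → ℕ × ℕ → Set
    Holds R (a , b) = ∀ {i j} → toℕ i ≡ a → toℕ j ≡ b → R (lookup vs i) (lookup vs j)

    at : ∀ {R} i j → R (lookup vs i) (lookup vs j) → Holds R (toℕ i , toℕ j)
    at i j r p q rewrite toℕ-injective p | toℕ-injective q = r

    edgeAt : ∀ i j → Adj G (lookup vs i) (lookup vs j) → Holds (Adj G) (toℕ i , toℕ j)
    edgeAt = at {Adj G}

    nonEdgeAt : ∀ i j → ¬ Adj G (lookup vs i) (lookup vs j) → Holds (λ u w → ¬ Adj G u w) (toℕ i , toℕ j)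
    nonEdgeAt = at {λ u w → ¬ Adj G u w}

    -- Equally coloured vertices are non-adjacent for free, so only the non-edges ne between
    -- the colour classes cs need proofs.
    fromEdgeList : (H : Graph k) {es : List (ℕ × ℕ)} → (∀ {i j} → Adj H i j ⇔ EdgeAdj es i j)
      → (cs : Vec Bool k) (b : Bool) (ne : List (ℕ × ℕ))
      → Pointwise (λ u c → σ u ≡ c xor b) vs cs
      → All (Holds (Adj G)) es → All (Holds (λ u w → ¬ Adj G u w)) ne
      → TwinFree H → Covered es (lookup cs) ne
      → InducedSubgraph H G
    fromEdgeList H {es} H⇔es cs b ne colours edges nonEdges twinFree covered =
      twinFree⇒induced H G twinFree (lookup vs) λ i j →
        mk⇔ (preserve i j ∘ to H⇔es)
            (λ a → from H⇔es (decidable-stable (edgeAdj? es i j) (λ ¬e → reflect i j ¬e a)))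
      where
      preserve : ∀ i j → EdgeAdj es i j → Adj G (lookup vs i) (lookup vs j)
      preserve i j (inj₁ ij∈) = All.lookup edges ij∈ refl refl
      preserve i j (inj₂ ji∈) = adj-sym G (All.lookup edges ji∈ refl refl)
      colour = Pointwise.lookup colours
      reflect : ∀ i j → ¬ EdgeAdj es i j → ¬ Adj G (lookup vs i) (lookup vs j)
      reflect i j ¬e with covered i j
      ... | inj₁ e = ⊥-elim (¬e e)
      ... | inj₂ (inj₁ same) = λ a → proper _ _ a (trans (colour i) (trans (cong (_xor b) same) (sym (colour j))))
      ... | inj₂ (inj₂ (inj₁ ij∈)) = All.lookup nonEdges ij∈ refl refl
      ... | inj₂ (inj₂ (inj₂ ji∈)) = All.lookup nonEdges ji∈ refl refl ∘ adj-sym G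

  alternating : Vec Bool 6
  alternating = false ∷ᵥ true ∷ᵥ false ∷ᵥ true ∷ᵥ false ∷ᵥ true ∷ᵥ []ᵥ

  P6-induced : ∀ {u₀ u₁ u₂ u₃ u₄ u₅}
    → Adj G u₀ u₁ → Adj G u₁ u₂ → Adj G u₂ u₃ → Adj G u₃ u₄ → Adj G u₄ u₅
    → ¬ Adj G u₀ u₃ → ¬ Adj G u₁ u₄ → ¬ Adj G u₂ u₅ → ¬ Adj G u₀ u₅
    → InducedSubgraph P6 G
  P6-induced {u₀} {u₁} {u₂} {u₃} {u₄} {u₅} e₀₁ e₁₂ e₂₃ e₃₄ e₄₅ n₀₃ n₁₄ n₂₅ n₀₅ =
    fromEdgeList vs P6 (mk⇔ id id) alternating (σ u₀) ne
      (refl ∷ₚ σ-flip e₀₁ ∷ₚ σ₂ ∷ₚ trans (σ-flip e₂₃) (cong not σ₂) ∷ₚ σ₄ ∷ₚ trans (σ-flip e₄₅) (cong not σ₄) ∷ₚ []ₚ)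
      (E (# 0) (# 1) e₀₁ ∷ E (# 1) (# 2) e₁₂ ∷ E (# 2) (# 3) e₂₃ ∷ E (# 3) (# 4) e₃₄ ∷ E (# 4) (# 5) e₄₅ ∷ [])
      (N (# 0) (# 3) n₀₃ ∷ N (# 1) (# 4) n₁₄ ∷ N (# 2) (# 5) n₂₅ ∷ N (# 0) (# 5) n₀₅ ∷ [])
      (from-yes (twinFree? P6)) (from-yes (covered? P6-edges (lookup alternating) ne))
    where
    vs = u₀ ∷ᵥ u₁ ∷ᵥ u₂ ∷ᵥ u₃ ∷ᵥ u₄ ∷ᵥ u₅ ∷ᵥ []ᵥ
    ne = (0 , 3) ∷ (1 , 4) ∷ (2 , 5) ∷ (0 , 5) ∷ []
    E = edgeAt vs
    N = nonEdgeAt vs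
    σ₂ : σ u₂ ≡ σ u₀
    σ₂ = σ-flip² e₀₁ e₁₂
    σ₄ : σ u₄ ≡ σ u₀
    σ₄ = trans (σ-flip² e₂₃ e₃₄) σ₂

  C6-induced : ∀ {u₀ u₁ u₂ u₃ u₄ u₅}
    → Adj G u₀ u₁ → Adj G u₁ u₂ → Adj G u₂ u₃ → Adj G u₃ u₄ → Adj G u₄ u₅ → Adj G u₅ u₀
    → ¬ Adj G u₀ u₃ → ¬ Adj G u₁ u₄ → ¬ Adj G u₂ u₅
    → InducedSubgraph C6 G
  C6-induced {u₀} {u₁} {u₂} {u₃} {u₄} {u₅} e₀₁ e₁₂ e₂₃ e₃₄ e₄₅ e₅₀ n₀₃ n₁₄ n₂₅ =
    fromEdgeList vs C6 (mk⇔ id id) alternating (σ u₀) ne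
      (refl ∷ₚ σ-flip e₀₁ ∷ₚ σ₂ ∷ₚ trans (σ-flip e₂₃) (cong not σ₂) ∷ₚ σ₄ ∷ₚ trans (σ-flip e₄₅) (cong not σ₄) ∷ₚ []ₚ)
      (E (# 0) (# 1) e₀₁ ∷ E (# 1) (# 2) e₁₂ ∷ E (# 2) (# 3) e₂₃ ∷ E (# 3) (# 4) e₃₄ ∷ E (# 4) (# 5) e₄₅ ∷ E (# 5) (# 0) e₅₀ ∷ [])
      (N (# 0) (# 3) n₀₃ ∷ N (# 1) (# 4) n₁₄ ∷ N (# 2) (# 5) n₂₅ ∷ [])
      (from-yes (twinFree? C6)) (from-yes (covered? C6-edges (lookup alternating) ne))
    where
    vs = u₀ ∷ᵥ u₁ ∷ᵥ u₂ ∷ᵥ u₃ ∷ᵥ u₄ ∷ᵥ u₅ ∷ᵥ []ᵥ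
    ne = (0 , 3) ∷ (1 , 4) ∷ (2 , 5) ∷ []
    E = edgeAt vs
    N = nonEdgeAt vs
    σ₂ : σ u₂ ≡ σ u₀
    σ₂ = σ-flip² e₀₁ e₁₂
    σ₄ : σ u₄ ≡ σ u₀
    σ₄ = trans (σ-flip² e₂₃ e₃₄) σ₂

  Sunlet4-induced : ∀ {u₀ u₁ u₂ u₃ u₄ u₅ u₆ u₇}
    → Adj G u₀ u₁ → Adj G u₁ u₂ → Adj G u₂ u₃ → Adj G u₃ u₀
    → Adj G u₀ u₄ → Adj G u₁ u₅ → Adj G u₂ u₆ → Adj G u₃ u₇
    → ¬ Adj G u₀ u₆ → ¬ Adj G u₂ u₄ → ¬ Adj G u₅ u₃ → ¬ Adj G u₅ u₄
    → ¬ Adj G u₅ u₆ → ¬ Adj G u₇ u₁ → ¬ Adj G u₇ u₄ → ¬ Adj G u₇ u₆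
    → InducedSubgraph Sunlet4 G
  Sunlet4-induced {u₀} {u₁} {u₂} {u₃} {u₄} {u₅} {u₆} {u₇}
    e₀₁ e₁₂ e₂₃ e₃₀ e₀₄ e₁₅ e₂₆ e₃₇ n₀₆ n₂₄ n₅₃ n₅₄ n₅₆ n₇₁ n₇₄ n₇₆ =
    fromEdgeList vs Sunlet4 (mk⇔ id id) cs (σ u₀) ne
      (refl ∷ₚ σ-flip e₀₁ ∷ₚ σ₂ ∷ₚ σ₃ ∷ₚ σ-flip e₀₄ ∷ₚ σ-flip² e₀₁ e₁₅ ∷ₚ trans (σ-flip e₂₆) (cong not σ₂)
        ∷ₚ trans (σ-flip² e₂₃ e₃₇) σ₂ ∷ₚ []ₚ)
      (E (# 0) (# 1) e₀₁ ∷ E (# 1) (# 2) e₁₂ ∷ E (# 2) (# 3) e₂₃ ∷ E (# 3) (# 0) e₃₀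
        ∷ E (# 0) (# 4) e₀₄ ∷ E (# 1) (# 5) e₁₅ ∷ E (# 2) (# 6) e₂₆ ∷ E (# 3) (# 7) e₃₇ ∷ [])
      (N (# 0) (# 6) n₀₆ ∷ N (# 2) (# 4) n₂₄ ∷ N (# 5) (# 3) n₅₃ ∷ N (# 5) (# 4) n₅₄
        ∷ N (# 5) (# 6) n₅₆ ∷ N (# 7) (# 1) n₇₁ ∷ N (# 7) (# 4) n₇₄ ∷ N (# 7) (# 6) n₇₆ ∷ [])
      (from-yes (twinFree? Sunlet4)) (from-yes (covered? Sunlet4-edges (lookup cs) ne))
    where
    vs = u₀ ∷ᵥ u₁ ∷ᵥ u₂ ∷ᵥ u₃ ∷ᵥ u₄ ∷ᵥ u₅ ∷ᵥ u₆ ∷ᵥ u₇ ∷ᵥ []ᵥ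
    cs = false ∷ᵥ true ∷ᵥ false ∷ᵥ true ∷ᵥ true ∷ᵥ false ∷ᵥ true ∷ᵥ false ∷ᵥ []ᵥ
    ne = (0 , 6) ∷ (2 , 4) ∷ (5 , 3) ∷ (5 , 4) ∷ (5 , 6) ∷ (7 , 1) ∷ (7 , 4) ∷ (7 , 6) ∷ []
    E = edgeAt vs
    N = nonEdgeAt vs
    σ₂ : σ u₂ ≡ σ u₀
    σ₂ = σ-flip² e₀₁ e₁₂
    σ₃ : σ u₃ ≡ not (σ u₀)
    σ₃ = trans (σ-flip e₂₃) (cong not σ₂)

degree : ∀ {n} → Graph n → Fin n → ℕ
degree G u = ∣ ⟦ adj-dec G u ⟧ ∣

module _ {n} (G : Graph n) (σ : Fin n → Bool) (v : Fin n) where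

  private
    covers? : ∀ u → Dec (σ u ≢ σ v → Adj G v u)
    covers? u = ¬? (σ u ≟B σ v) →-dec adj-dec G v u

  heartVertex-or-far : HeartVertex G σ v ⊎ ∃[ y ] σ y ≢ σ v × ¬ Adj G v y
  heartVertex-or-far with all? covers?
  ... | yes heart = inj₁ heart
  ... | no ¬heart with ¬∀⟶∃¬ n _ covers? ¬heart
  ...   | y , ¬covers = inj₂ (y , (λ y≡v → ¬covers λ y≢v → ⊥-elim (y≢v y≡v)) , (λ vy → ¬covers λ _ → vy))

module P6C6Sunlet4Free {n} (G : Graph n) (σ : Fin n → Bool) (proper : ProperTwoColouring G σ)
  (noP6 : ¬ InducedSubgraph P6 G) (noC6 : ¬ InducedSubgraph C6 G) (noS4 : ¬ InducedSubgraph Sunlet4 G) where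

  open EdgeListEmbedding G σ proper

  adj? : ∀ u → Decidable (Adj G u)
  adj? = adj-dec G

  ¬adj-sym : ∀ {u w} → ¬ Adj G u w → ¬ Adj G w u
  ¬adj-sym ¬uw = ¬uw ∘ adj-sym G

  module MaxDegree (v : Fin n) (v-max : ∀ u → degree G u ≤ degree G v) where

    v-dominates : ∀ {a y} → Adj G a y → ¬ Adj G v y → ∃[ x ] Adj G v x × ¬ Adj G a x
    v-dominates {a} ay ¬vy = ∣⟦⟧∣≤⇒⊈ (adj? v) (adj? a) (v-max a) ay ¬vy

    _⊈ᵥ_ : Fin n → Fin n → Set
    a ⊈ᵥ b = ∃[ x ] Adj G v x × Adj G a x × ¬ Adj G b x

    comparable : ∀ {a b z} → Adj G b z → ¬ Adj G v z → b ⊈ᵥ a → a ⊈ᵥ b → ⊥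
    comparable {a} {b} {z} bz ¬vz (x , vx , bx , ¬ax) (x′ , vx′ , ax′ , ¬bx′) with adj? a z
    ... | no ¬az = noP6 (P6-induced (adj-sym G bz) bx (adj-sym G vx) vx′ (adj-sym G ax′)
                                    (¬adj-sym ¬vz) ¬bx′ (¬adj-sym ¬ax) (¬adj-sym ¬az))
    ... | yes az = noC6 (C6-induced (adj-sym G bz) bx (adj-sym G vx) vx′ (adj-sym G ax′) az
                                    (¬adj-sym ¬vz) ¬bx′ (¬adj-sym ¬ax))

    square-with-pendants : ∀ {x a x′ p b y u}
      → Adj G v x → Adj G a x → Adj G a x′ → Adj G v x′
      → Adj G v p → Adj G b x → Adj G a y → Adj G u x′
      → ¬ Adj G a p → ¬ Adj G v y → ¬ Adj G b x′ → ¬ Adj G u x → ⊥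
    square-with-pendants {x} {a} {x′} {p} {b} {y} {u} vx ax ax′ vx′ vp bx ay ux′ ¬ap ¬vy ¬bx′ ¬ux
      with adj? u p | adj? b p | adj? b y | adj? u y
    ... | yes up | _ | _ | _ = comparable ay ¬vy (x , vx , ax , ¬ux) (p , vp , up , ¬ap)
    ... | _ | yes bp | _ | _ = comparable ay ¬vy (x′ , vx′ , ax′ , ¬bx′) (p , vp , bp , ¬ap)
    ... | _ | _ | yes by | _ = comparable by ¬vy (x , vx , bx , ¬ux) (x′ , vx′ , ux′ , ¬bx′)
    ... | _ | _ | _ | yes uy = comparable uy ¬vy (x′ , vx′ , ux′ , ¬bx′) (x , vx , bx , ¬ux)
    ... | no ¬up | no ¬bp | no ¬by | no ¬uy =
      noS4 (Sunlet4-induced vx (adj-sym G ax) ax′ (adj-sym G vx′) vp (adj-sym G bx) ay (adj-sym G ux′)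
                            ¬vy ¬ap ¬bx′ ¬bp ¬by ¬ux ¬up ¬uy)

    common? : ∀ a → Decidable (λ x → Adj G v x × Adj G a x)
    common? a x = adj? v x ×-dec adj? a x

    SharesNeighbour : Fin n → Set
    SharesNeighbour a = ∃[ x ] Adj G v x × Adj G a x

    -- Propagated along walks from v, this shows that every vertex on v's side is within distance 2 of v.
    Placed : Fin n → Set
    Placed u = (σ u ≡ σ v → SharesNeighbour u) × (σ u ≢ σ v → ∃[ a ] Adj G a u × SharesNeighbour a)

    placed-step : ∀ {s m} → Placed s → Adj G s m → Placed m
    placed-step {s} {m} (shares , attached) sm = same-side , other-side
      where
      other-side : σ m ≢ σ v → ∃[ a ] Adj G a m × SharesNeighbour a
      other-side m≢v = s , sm , shares (≢∧≢⇒≡ (proper s m sm) (m≢v ∘ sym))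
      same-side : σ m ≡ σ v → SharesNeighbour m
      same-side m≡v with attached (proper s m sm ∘ λ s≡v → trans s≡v (sym m≡v)) | adj? v s
      ... | _ | yes vs = s , vs , adj-sym G sm
      ... | a , as , x′ , vx′ , ax′ | no ¬vs with v-dominates as ¬vs | any? (common? m)
      ...   | _ | yes shared = shared
      ...   | x″ , vx″ , ¬ax″ | no ∄x =
        ⊥-elim (noP6 (P6-induced (adj-sym G vx″) vx′ (adj-sym G ax′) as sm (¬adj-sym ¬ax″) ¬vs
                                 (λ x′m → ∄x (x′ , vx′ , adj-sym G x′m)) (λ x″m → ∄x (x″ , vx″ , adj-sym G x″m))))

    placed-walk : ∀ {s t} → Walk G s t → Placed s → Placed t
    placed-walk here placed = placed
    placed-walk (step sm walk) placed = placed-walk walk (placed-step placed sm)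

    shares-neighbour : ∀ {x} → Adj G v x → (∀ u → Walk G v u) → ∀ {a} → σ a ≡ σ v → SharesNeighbour a
    shares-neighbour {x} vx walk {a} = proj₁ (placed-walk (walk a) ((λ _ → x , vx , vx) , λ v≢v → ⊥-elim (v≢v refl)))

    μ : Fin n → ℕ
    μ a = ∣ ⟦ common? a ⟧ ∣

    module _ {a₀ y p aₘ h} (a₀y : Adj G a₀ y) (y≢v : σ y ≢ σ v) (¬vy : ¬ Adj G v y)
             (vp : Adj G v p) (¬a₀p : ¬ Adj G a₀ p)
             (aₘ-min : ∀ u → σ u ≡ σ v → μ aₘ ≤ μ u) (vh : Adj G v h) (aₘh : Adj G aₘ h) where

      minimal : ∀ {u} → σ u ≡ σ v → ¬ Adj G u h → u ⊈ᵥ aₘ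
      minimal {u} u-side ¬uh with ∣⟦⟧∣≤⇒⊈ (common? u) (common? aₘ) (aₘ-min u u-side) (vh , aₘh) (¬uh ∘ proj₂)
      ... | x , (vx , ux) , ¬common = x , vx , ux , λ aₘx → ¬common (vx , aₘx)

      excluded : ∀ {u} → σ u ≡ σ v → ¬ Adj G u h → ⊥
      excluded u-side ¬uh with minimal u-side ¬uh | adj? a₀ h
      ... | _ | no ¬a₀h =
        comparable a₀y ¬vy (minimal (≢∧≢⇒≡ (proper a₀ y a₀y) (y≢v ∘ sym)) ¬a₀h) (h , vh , aₘh , ¬a₀h)
      ... | x′ , vx′ , ux′ , ¬aₘx′ | yes a₀h with adj? a₀ x′
      ...   | no ¬a₀x′ = comparable a₀y ¬vy (h , vh , a₀h , ¬uh) (x′ , vx′ , ux′ , ¬a₀x′)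
      ...   | yes a₀x′ = square-with-pendants vh a₀h a₀x′ vx′ vp aₘh a₀y ux′ ¬a₀p ¬vy ¬aₘx′ ¬uh

      heart : HeartVertex G σ h
      heart u u≢h = decidable-stable (adj? h u) λ ¬hu → excluded (≢∧≢⇒≡ u≢h (proper v h vh)) (¬adj-sym ¬hu)

proposition6p2 : {n : ℕ} (G : Graph n) (σ : Fin n → Bool)
    → Connected G
    → ProperTwoColouring G σ
    → ¬ InducedSubgraph P6 G
    → ¬ InducedSubgraph C6 G
    → ¬ InducedSubgraph Sunlet4 G
    → Σ (Fin n) (λ v → HeartVertex G σ v)
proposition6p2 {n} G σ (v₀ , walk) proper noP6 noC6 noS4 with maximiser (degree G) v₀
... | v , v-max with heartVertex-or-far G σ v
...   | inj₁ v-heart = v , v-heart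
...   | inj₂ (y , y≢v , ¬vy) = heart-vertex
  where
  open P6C6Sunlet4Free G σ proper noP6 noC6 noS4
  open MaxDegree v v-max
  heart-vertex : Σ (Fin n) (HeartVertex G σ)
  heart-vertex with neighbour-of-walk-start (y≢v ∘ cong σ) (walk y v)
  ... | a₀ , ya₀ with v-dominates (adj-sym G ya₀) ¬vy
  ... | p , vp , ¬a₀p with minimiser μ (λ a → σ a ≟B σ v) {v} refl
  ... | aₘ , aₘ-side , aₘ-min with shares-neighbour vp (walk v) aₘ-side
  ... | h , vh , aₘh = h , heart (adj-sym G ya₀) y≢v ¬vy vp ¬a₀p aₘ-min vh aₘh
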